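{- Let $\mathcal{I}=\langle S,\circ,*,i,e\rangle$ be a Routley proto-IF. Then $\|\alpha\|$ is a proper filter in the proto-model $\langle \mathcal{I},V\rangle$ for every valuation $V$ on $\mathcal{I}$ and every $L$-formula $\alpha$ if and only if the following three conditions hold: (a) $i^*=e$ and $e^*=i$; (b) for all $t,u\in S$, if $t\le u$ then $u^*\le t^*$; (c) for all $t,u\in S$, $(t\circ u)^*\le t^*$ or $(t\circ u)^*\le u^*$.
   Context: Let $At$ be a set of atomic formulas and $L$ the set of formulas built from $At$ with the connectives $\wedge,\vee,\neg$. A Routley information proto-frame (Routley proto-IF) is a structure $\langle S,\circ,*,i,e\rangle$ where $S$ is a nonempty set, $\circ$ is an associative, commutative and idempotent binary operation on $S$, $*:S\to S$ is a function (written $s\mapsto s^*$), and $i,e$ are two distinct elements of $S$ such that $s\circ i=s$ and $s\circ e=e$ for all $s\in S$, and for all $t,u\in S$, if $e=t\circ u$ then $e=t$ or $e=u$. The order is defined by $s\le t$ iff $s\circ t=s$. A proper filter is a set $F\subseteq S$ with $i\in F$, $e\notin F$, and for all $t,u\in S$: $t\circ u\in F$ iff $t\in F$ and $u\in F$. A valuation is a function $V$ assigning to each atomic formula a proper filter. Given a valuation, support $\Vdash$ is defined by: $s\Vdash p$ iff $s\in V(p)$; $s\Vdash\alpha\wedge\beta$ iff $s\Vdash\alpha$ and $s\Vdash\beta$; $s\Vdash\alpha\vee\beta$ iff there are $t,u\in S$ with $t\Vdash\alpha$, $u\Vdash\beta$ and $t\circ u\le s$; $s\Vdash\neg\alpha$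 iff $s^*\nVdash\alpha$. $\|\alpha\|$ denotes the set of states supporting $\alpha$. -}

module Defs where

open import Data.Product using (Σ; _×_; _,_; ∃; ∃-syntax)
open import Data.Sum using (_⊎_)
open import Relation.Nullary using (¬_)
open import Relation.Binary.PropositionalEquality using (_≡_; _≢_)

data Formula (At : Set) : Set where
  atom : At → Formula At
  _∧ᶠ_ : Formula At → Formula At → Formula At
  _∨ᶠ_ : Formula At → Formula At → Formula At
  ¬ᶠ_  : Formula At → Formula At

record RoutleyProtoIF : Set₁ where
  field
    S     : Set
    _∘_   : S → S → S
    _*    : S → S
    i     : S
    e     : S
    ∘-assoc : ∀ s t u → (s ∘ t) ∘ u ≡ s ∘ (t ∘ u)
    ∘-comm  : ∀ s t → s ∘ t ≡ t ∘ s
    ∘-idem  : ∀ s → s ∘ s ≡ s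
    i≢e     : i ≢ e
    ∘-i     : ∀ s → s ∘ i ≡ s
    ∘-e     : ∀ s → s ∘ e ≡ e
    e-prime : ∀ t u → e ≡ t ∘ u → (e ≡ t) ⊎ (e ≡ u)

  _≤_ : S → S → Set
  s ≤ t = s ∘ t ≡ s

  Subset : Set₁
  Subset = S → Set

  IsProperFilter : Subset → Set
  IsProperFilter F =
    F i × ¬ F e × (∀ t u → (F (t ∘ u) → F t × F u) × (F t × F u → F (t ∘ u)))

  Valuation : Set → Set₁
  Valuation At = Σ (At → Subset) λ V → ∀ p → IsProperFilter (V p)

  Supports : {At : Set} → (At → Subset) → S → Formula At → Set
  Supports V s (atom p) = V p s
  Supports V s (α ∧ᶠ β) = Supports V s α × Supports V s β
  Supports V s (α ∨ᶠ β) =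
    ∃[ t ] ∃[ u ] (Supports V t α × Supports V u β × (t ∘ u) ≤ s)
  Supports V s (¬ᶠ α) = ¬ Supports V (s *) α

  ⟦_⟧ : {At : Set} → Valuation At → Formula At → Subset
  ⟦ (V , _) ⟧ α = λ s → Supports V s α

  CondA : Set
  CondA = (i * ≡ e) × (e * ≡ i)

  CondB : Set
  CondB = ∀ t u → t ≤ u → (u *) ≤ (t *)

  CondC : Set
  CondC = ∀ t u → ((t ∘ u) *) ≤ (t *) ⊎ ((t ∘ u) *) ≤ (u *)

-- Under (a)–(c) the operations ∧, ∨, ¬ on truth sets each preserve proper
-- filters: ∨ by primeness of e, ¬ by (a) at the points i and e, by (b) for
-- upward closure and by (c) for closure under ∘. Conversely, valuing an atom
-- p by the principal filter ↑ x of a state x ≠ e makes ‖¬p‖ the set of states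
-- s with x ≰ s*; with x := i*, i, u* and (t ∘ u)* the filter properties of
-- ‖¬p‖ yield (a)–(c), classically.
module Submission where

open import Defs
open import Data.Product using (Σ; _×_; _,_; proj₁; proj₂)
open import Data.Sum using (inj₁; inj₂; [_,_]′)
open import Function using (_∘′_)
open import Relation.Nullary using (¬_)
open import Relation.Binary.PropositionalEquality
  using (_≡_; _≢_; refl; sym; trans; cong₂; subst; isEquivalence)
open import Relation.Binary.Lattice using (module MeetSemilattice)
open import Algebra.Lattice.Bundles using (Semilattice)
open import Algebra.Lattice.Properties.Semilattice using (∧-orderTheoreticMeetSemilattice)
import Relation.Binary.Lattice.Properties.MeetSemilattice as MeetSemilatticeProperties
open import Axiom.ExcludedMiddle using (ExcludedMiddle)
open import Axiom.DoubleNegationElimination using (DoubleNegationElimination; em⇒dne)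
open import Level using (0ℓ)

module RoutleyFrame (I : RoutleyProtoIF) where
  open RoutleyProtoIF I

  semilattice : Semilattice 0ℓ 0ℓ
  semilattice = record
    { Carrier = S ; _≈_ = _≡_ ; _∙_ = _∘_
    ; isSemilattice = record
      { isBand = record
        { isSemigroup = record
          { isMagma = record { isEquivalence = isEquivalence ; ∙-cong = cong₂ _∘_ }
          ; assoc = ∘-assoc }
        ; idem = ∘-idem }
      ; comm = ∘-comm } }

  -- The library orders a semilattice by x ≡ x ∘ y, the symmetric form of _≤_.
  private
    meetSemilattice = ∧-orderTheoreticMeetSemilattice semilattice
    module ⊑ = MeetSemilattice meetSemilattice
    open MeetSemilatticeProperties meetSemilattice using (∧-monotonic)

  ≤-refl : ∀ x → x ≤ x
  ≤-refl = ∘-idem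

  ≤-trans : ∀ {x y z} → x ≤ y → y ≤ z → x ≤ z
  ≤-trans x≤y y≤z = sym (⊑.trans (sym x≤y) (sym y≤z))

  x∘y≤x : ∀ x y → (x ∘ y) ≤ x
  x∘y≤x x y = sym (⊑.x∧y≤x x y)

  x∘y≤y : ∀ x y → (x ∘ y) ≤ y
  x∘y≤y x y = sym (⊑.x∧y≤y x y)

  ≤-antisym : ∀ {x y} → x ≤ y → y ≤ x → x ≡ y
  ≤-antisym x≤y y≤x = ⊑.antisym (sym x≤y) (sym y≤x)

  ∘-mono-≤ : ∀ {x y u v} → x ≤ y → u ≤ v → (x ∘ u) ≤ (y ∘ v)
  ∘-mono-≤ x≤y u≤v = sym (∧-monotonic (sym x≤y) (sym u≤v))

  ∘-greatest : ∀ {x y z} → x ≤ y → x ≤ z → x ≤ (y ∘ z)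
  ∘-greatest x≤y x≤z = sym (⊑.∧-greatest (sym x≤y) (sym x≤z))

  e≤x : ∀ x → e ≤ x
  e≤x x = trans (∘-comm e x) (∘-e x)

  x≰y⇒x≢e : ∀ {x y} → ¬ x ≤ y → x ≢ e
  x≰y⇒x≢e {y = y} x≰y x≡e = x≰y (subst (_≤ y) (sym x≡e) (e≤x y))

  module _ {F : Subset} (F-proper : IsProperFilter F) where

    private
      ∘-closed = proj₂ (proj₂ F-proper)

    filter-∘⁻ : ∀ {t u} → F (t ∘ u) → F t × F u
    filter-∘⁻ = proj₁ (∘-closed _ _)

    filter-∘⁺ : ∀ {t u} → F t → F u → F (t ∘ u)
    filter-∘⁺ Ft Fu = proj₂ (∘-closed _ _) (Ft , Fu)

    filter-upward-closed : ∀ {t u} → t ≤ u → F t → F u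
    filter-upward-closed t≤u Ft = proj₂ (filter-∘⁻ (subst F (sym t≤u) Ft))

  ↑_ : S → Subset
  (↑ x) s = x ≤ s

  ↑-isProperFilter : ∀ {x} → x ≢ e → IsProperFilter (↑ x)
  ↑-isProperFilter {x} x≢e =
    ∘-i x , (λ x≤e → x≢e (trans (sym x≤e) (∘-e x))) ,
    λ t u → (λ x≤t∘u → ≤-trans x≤t∘u (x∘y≤x t u) , ≤-trans x≤t∘u (x∘y≤y t u))
          , λ { (x≤t , x≤u) → ∘-greatest x≤t x≤u }

  _∩_ : Subset → Subset → Subset
  (F ∩ G) s = F s × G s

  _⊔_ : Subset → Subset → Subset
  (F ⊔ G) s = Σ S λ t → Σ S λ u → F t × G u × (t ∘ u) ≤ s

  ∼_ : Subset → Subset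
  (∼ F) s = ¬ F (s *)

  ∩-isProperFilter : ∀ {F G} → IsProperFilter F → IsProperFilter G → IsProperFilter (F ∩ G)
  ∩-isProperFilter F-proper@(Fi , ¬Fe , _) G-proper@(Gi , ¬Ge , _) =
    (Fi , Gi) , ¬Fe ∘′ proj₁ , λ t u →
      (λ { (Ft∘u , Gt∘u) → let Ft , Fu = filter-∘⁻ F-proper Ft∘u
                               Gt , Gu = filter-∘⁻ G-proper Gt∘u
                           in (Ft , Gt) , (Fu , Gu) })
      , λ { ((Ft , Gt) , (Fu , Gu)) → filter-∘⁺ F-proper Ft Fu , filter-∘⁺ G-proper Gt Gu }

  ⊔-isProperFilter : ∀ {F G} → IsProperFilter F → IsProperFilter G → IsProperFilter (F ⊔ G)
  ⊔-isProperFilter {F} {G} F-proper@(Fi , ¬Fe , _) G-proper@(Gi , ¬Ge , _) =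
    (i , i , Fi , Gi , ∘-i (i ∘ i)) , e∉F⊔G , λ s s′ → (F⊔G-∘⁻ s s′ , F⊔G-∘⁺ s s′)
    where
    e∉F⊔G : ¬ (F ⊔ G) e
    e∉F⊔G (t , u , Ft , Gu , t∘u≤e) =
      [ (λ e≡t → ¬Fe (subst F (sym e≡t) Ft)) , (λ e≡u → ¬Ge (subst G (sym e≡u) Gu)) ]′
        (e-prime t u (trans (sym (∘-e (t ∘ u))) t∘u≤e))

    F⊔G-∘⁻ : ∀ s s′ → (F ⊔ G) (s ∘ s′) → (F ⊔ G) s × (F ⊔ G) s′
    F⊔G-∘⁻ s s′ (t , u , Ft , Gu , t∘u≤s∘s′) =
      (t , u , Ft , Gu , ≤-trans t∘u≤s∘s′ (x∘y≤x s s′)) ,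
      (t , u , Ft , Gu , ≤-trans t∘u≤s∘s′ (x∘y≤y s s′))

    F⊔G-∘⁺ : ∀ s s′ → (F ⊔ G) s × (F ⊔ G) s′ → (F ⊔ G) (s ∘ s′)
    F⊔G-∘⁺ s s′ ((t , u , Ft , Gu , t∘u≤s) , (t′ , u′ , Ft′ , Gu′ , t′∘u′≤s′)) =
      t ∘ t′ , u ∘ u′ , filter-∘⁺ F-proper Ft Ft′ , filter-∘⁺ G-proper Gu Gu′ ,
      ∘-greatest (≤-trans (∘-mono-≤ (x∘y≤x t t′) (x∘y≤x u u′)) t∘u≤s)
                 (≤-trans (∘-mono-≤ (x∘y≤y t t′) (x∘y≤y u u′)) t′∘u′≤s′)

  ∼-isProperFilter : CondA → CondB → CondC → ∀ {F} → IsProperFilter F → IsProperFilter (∼ F)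
  ∼-isProperFilter (i*≡e , e*≡i) antitone split {F} F-proper@(Fi , ¬Fe , _) =
    (λ Fi* → ¬Fe (subst F i*≡e Fi*)) , (λ ¬Fe* → ¬Fe* (subst F (sym e*≡i) Fi)) ,
    λ t u → (λ ¬F[t∘u]* → (λ Ft* → ¬F[t∘u]* (lift (x∘y≤x t u) Ft*))
                        , (λ Fu* → ¬F[t∘u]* (lift (x∘y≤y t u) Fu*)))
          , λ { (¬Ft* , ¬Fu*) F[t∘u]* →
                  [ (λ ≤t* → ¬Ft* (filter-upward-closed F-proper ≤t* F[t∘u]*))
                  , (λ ≤u* → ¬Fu* (filter-upward-closed F-proper ≤u* F[t∘u]*))
                  ]′ (split t u) }
    where
    lift : ∀ {t u} → t ≤ u → F (u *) → F (t *)
    lift t≤u = filter-upward-closed F-proper (antitone _ _ t≤u)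

  ⟦⟧-isProperFilter : CondA → CondB → CondC →
                      ∀ {At} (V : Valuation At) α → IsProperFilter (⟦ V ⟧ α)
  ⟦⟧-isProperFilter a b c V (atom p) = proj₂ V p
  ⟦⟧-isProperFilter a b c V (α ∧ᶠ β) =
    ∩-isProperFilter (⟦⟧-isProperFilter a b c V α) (⟦⟧-isProperFilter a b c V β)
  ⟦⟧-isProperFilter a b c V (α ∨ᶠ β) =
    ⊔-isProperFilter (⟦⟧-isProperFilter a b c V α) (⟦⟧-isProperFilter a b c V β)
  ⟦⟧-isProperFilter a b c V (¬ᶠ α) = ∼-isProperFilter a b c (⟦⟧-isProperFilter a b c V α)

  principal : ∀ {At x} → x ≢ e → Valuation At
  principal x≢e = (λ _ → ↑ _) , λ _ → ↑-isProperFilter x≢e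

  ⟦¬p⟧-principal : ∀ {At x} (x≢e : x ≢ e) p → ⟦ principal {At} x≢e ⟧ (¬ᶠ atom p) ≡ ∼ ↑ x
  ⟦¬p⟧-principal x≢e p = refl

  module _ (dne : DoubleNegationElimination 0ℓ)
           (∼↑-proper : ∀ {x} → x ≢ e → IsProperFilter (∼ ↑ x)) where

    ∼↑-proper⇒CondA : CondA
    ∼↑-proper⇒CondA = i*≡e , ≤-antisym (∘-i (e *)) i≤e*
      where
      i*≡e = dne λ i*≢e → proj₁ (∼↑-proper i*≢e) (≤-refl (i *))
      i≤e* = dne (proj₁ (proj₂ (∼↑-proper i≢e)))

    ∼↑-proper⇒CondB : CondB
    ∼↑-proper⇒CondB t u t≤u = dne λ u*≰t* →
      filter-upward-closed (∼↑-proper (x≰y⇒x≢e u*≰t*)) t≤u u*≰t* (≤-refl (u *))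

    ∼↑-proper⇒CondC : CondC
    ∼↑-proper⇒CondC t u = dne λ ¬split →
      let x≢e = x≰y⇒x≢e (¬split ∘′ inj₁)
      in filter-∘⁺ (∼↑-proper x≢e) (¬split ∘′ inj₁) (¬split ∘′ inj₂) (≤-refl ((t ∘ u) *))

  ⟦⟧-proper⇒CondABC : DoubleNegationElimination 0ℓ → ∀ {At} → At →
                      (∀ (V : Valuation At) α → IsProperFilter (⟦ V ⟧ α)) →
                      CondA × CondB × CondC
  ⟦⟧-proper⇒CondABC dne p all-proper =
    ∼↑-proper⇒CondA dne ∼↑-proper , ∼↑-proper⇒CondB dne ∼↑-proper ,
    ∼↑-proper⇒CondC dne ∼↑-proper
    where
    ∼↑-proper : ∀ {x} → x ≢ e → IsProperFilter (∼ ↑ x)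
    ∼↑-proper x≢e = subst IsProperFilter (⟦¬p⟧-principal x≢e p)
                                         (all-proper (principal x≢e) (¬ᶠ atom p))

proposition1 : ExcludedMiddle 0ℓ → (At : Set) → At → (I : RoutleyProtoIF) →
    let open RoutleyProtoIF I in
    ((∀ (V : Valuation At) (α : Formula At) → IsProperFilter (⟦ V ⟧ α))
      → CondA × CondB × CondC)
    × (CondA × CondB × CondC
      → ∀ (V : Valuation At) (α : Formula At) → IsProperFilter (⟦ V ⟧ α))
proposition1 em At p I =
  ⟦⟧-proper⇒CondABC (em⇒dne em) p , λ { (a , b , c) → ⟦⟧-isProperFilter a b c }
  where open RoutleyFrame I
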